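{- For any two graphs $G$ and $H$, \[ \gamma(G\diamond H)\leq\min\{\gamma(G)+\gamma(H)-1,\ \gamma_{t}(\overline{G})+\gamma_{t}(\overline{H})-1\}. \]
   Context: All graphs are finite, simple and undirected. For a graph $G$, $\overline{G}$ denotes its complement. The modular product $G\diamond H$ has vertex set $V(G)\times V(H)$, and two distinct vertices $(g,h)$ and $(g',h')$ are adjacent iff either ($g=g'$ and $hh'\in E(H)$), or ($gg'\in E(G)$ and $h=h'$), or ($gg'\in E(G)$ and $hh'\in E(H)$), or ($g\neq g'$, $h\neq h'$, $gg'\notin E(G)$ and $hh'\notin E(H)$). $\gamma(G)$ is the domination number (minimum size of a set $D$ such that every vertex outside $D$ has a neighbor in $D$). $\gamma_t(G)$ is the total domination number (minimum size of a set $D$ such that every vertex of $G$ has a neighbor in $D$), with $\gamma_t(G)=\infty$ if no such set exists. -}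

module Defs where

open import Level using (0ℓ)
open import Data.Nat using (ℕ; _≤_)
open import Data.Fin using (Fin)
open import Data.Fin.Properties using () renaming (_≟_ to _≟ᶠ_)
open import Data.Product using (Σ; _×_; _,_; ∃; ∃-syntax)
open import Data.Sum using (_⊎_)
open import Data.List using (List; length)
open import Data.List.Membership.Propositional using (_∈_)
open import Data.List.Relation.Unary.Unique.Propositional using (Unique)
open import Relation.Nullary using (¬_; Dec)
open import Relation.Binary.PropositionalEquality using (_≡_)

record Graph (n : ℕ) : Set₁ where
  field
    Adj     : Fin n → Fin n → Set
    adj?    : ∀ u v → Dec (Adj u v)
    sym     : ∀ {u v} → Adj u v → Adj v u
    irrefl  : ∀ {u} → ¬ Adj u u
open Graph public

complement : ∀ {n} → Graph n → Graph n
complement G = record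
  { Adj    = λ u v → ¬ (u ≡ v) × ¬ Adj G u v
  ; adj?   = λ u v → dec u v
  ; sym    = λ { (u≢v , nuv) → (λ e → u≢v (Relation.Binary.PropositionalEquality.sym e)) , (λ a → nuv (Graph.sym G a)) }
  ; irrefl = λ { (u≢u , _) → u≢u Relation.Binary.PropositionalEquality.refl }
  }
  where
  open import Relation.Nullary.Decidable using (_×-dec_; ¬?)
  dec : ∀ u v → Dec (¬ (u ≡ v) × ¬ Adj G u v)
  dec u v = ¬? (u ≟ᶠ v) ×-dec ¬? (adj? G u v)

-- Adjacency of the modular product on Fin m × Fin n.
ModAdj : ∀ {m n} → Graph m → Graph n → (Fin m × Fin n) → (Fin m × Fin n) → Set
ModAdj G H (g , h) (g' , h') =
    (g ≡ g' × Adj H h h')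
  ⊎ (Adj G g g' × h ≡ h')
  ⊎ (Adj G g g' × Adj H h h')
  ⊎ (¬ g ≡ g' × ¬ h ≡ h' × ¬ Adj G g g' × ¬ Adj H h h')

-- Generic domination notions for a graph given by an adjacency relation on a type V.
-- A set is a duplicate-free list; its size is its length.
Dominating : {V : Set} → (V → V → Set) → List V → Set
Dominating {V} A D = ∀ v → v ∈ D ⊎ (∃[ u ] (u ∈ D × A u v))

TotalDominating : {V : Set} → (V → V → Set) → List V → Set
TotalDominating {V} A D = ∀ v → ∃[ u ] (u ∈ D × A u v)

IsMinSize : {V : Set} → (List V → Set) → ℕ → Set
IsMinSize {V} P d =
  (∃[ D ] (Unique D × P D × length D ≡ d)) ×
  (∀ D → Unique D → P D → d ≤ length D)

IsDomNum : ∀ {n} → Graph n → ℕ → Set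
IsDomNum G d = IsMinSize (Dominating (Adj G)) d

-- γ_t(G) = d  (finite case; γ_t(G) = ∞ iff no total dominating set exists)
IsTotDomNum : ∀ {n} → Graph n → ℕ → Set
IsTotDomNum G d = IsMinSize (TotalDominating (Adj G)) d

IsDomNumModProd : ∀ {m n} → Graph m → Graph n → ℕ → Set
IsDomNumModProd G H d = IsMinSize (Dominating (ModAdj G H)) d

{-# OPTIONS --safe #-}
module Submission where

-- Pick g₀ in a minimum dominating set A of G and h₀ in one, B, of H. The cross
-- {g₀} × B ∪ A × {h₀} has |A| + |B| - 1 elements and dominates G ⋄ H, because the
-- closed neighbourhood of (g, h) in G ⋄ H contains N[g] × N[h] and N_Ḡ(g) × N_H̄(h):
-- if g ∈ N[g₀], a B-dominator h' of h gives (g₀, h') ∈ N[(g, h)]; symmetrically if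
-- h ∈ N[h₀]; otherwise g₀ and h₀ are non-neighbours of g and h, so (g₀, h₀) is a
-- neighbour. For total dominating sets A, B of Ḡ and H̄ the same cross works: if
-- g ∉ N[g₀], then (g₀, h') is a neighbour for an H̄-neighbour h' ∈ B of h;
-- symmetrically if h ∉ N[h₀]; otherwise (g₀, h₀) ∈ N[g] × N[h].

open import Defs
open import Data.Nat using (ℕ; suc; _≤_; _+_; _∸_)
open import Data.Nat.Properties using (≤-trans; ≤-reflexive; +-comm)
open import Data.Fin using (Fin)
open import Data.Fin.Properties using (_≟_)
open import Data.Product using (_×_; _,_; ∃-syntax)
open import Data.Product.Properties using (≡-dec)
open import Data.Sum using (_⊎_; inj₁; inj₂)
open import Data.List using (List; []; _∷_; _++_; map; length; deduplicate)
open import Data.List.Properties using (length-deduplicate; length-++; length-map)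
open import Data.List.Membership.Propositional using (_∈_)
open import Data.List.Membership.Propositional.Properties using (∈-deduplicate⁺; ∈-map⁺; ∈-++⁺ˡ; ∈-++⁺ʳ)
open import Data.List.Relation.Binary.Subset.Propositional using (_⊆_)
open import Data.List.Relation.Unary.Any using (here; there)
open import Data.List.Relation.Unary.Unique.DecPropositional.Properties using (deduplicate-!)
open import Data.Empty using (⊥-elim)
open import Relation.Nullary using (¬_; yes; no)
open import Relation.Binary.Definitions using (DecidableEquality)
open import Relation.Binary.Construct.Closure.Reflexive using (ReflClosure; refl; [_])
open import Relation.Binary.Construct.Closure.Reflexive.Properties using (fromSum)
import Relation.Binary.Construct.Closure.Reflexive.Properties as ReflClosure
open import Relation.Binary.PropositionalEquality using (_≡_; refl; cong₂)
open Relation.Binary.PropositionalEquality.≡-Reasoning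

module _ {V : Set} {E : V → V → Set} where

  DominatedBy : List V → V → Set
  DominatedBy D v = v ∈ D ⊎ ∃[ u ] (u ∈ D × E u v)

  closedNeighbour⇒dominatedBy : ∀ {D u v} → u ∈ D → ReflClosure E u v → DominatedBy D v
  closedNeighbour⇒dominatedBy u∈D refl    = inj₁ u∈D
  closedNeighbour⇒dominatedBy u∈D [ uv ] = inj₂ (_ , u∈D , uv)

  dominatedBy⇒closedNeighbour : ∀ {D v} → DominatedBy D v → ∃[ u ] (u ∈ D × ReflClosure E u v)
  dominatedBy⇒closedNeighbour (inj₁ v∈D)           = _ , v∈D , refl
  dominatedBy⇒closedNeighbour (inj₂ (u , u∈D , uv)) = u , u∈D , [ uv ]

  dominatedBy-mono : ∀ {D D' v} → D ⊆ D' → DominatedBy D v → DominatedBy D' v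
  dominatedBy-mono D⊆D' (inj₁ v∈D)           = inj₁ (D⊆D' v∈D)
  dominatedBy-mono D⊆D' (inj₂ (u , u∈D , uv)) = inj₂ (u , D⊆D' u∈D , uv)

  Dominating-mono : ∀ {D D'} → D ⊆ D' → Dominating E D → Dominating E D'
  Dominating-mono D⊆D' dom v = dominatedBy-mono D⊆D' (dom v)

  ¬Dominating-[] : V → ¬ Dominating E []
  ¬Dominating-[] v dom with dom v
  ... | inj₁ ()
  ... | inj₂ (_ , () , _)

  ¬TotalDominating-[] : V → ¬ TotalDominating E []
  ¬TotalDominating-[] v dom with dom v
  ... | _ , () , _

minSize≤length : ∀ {V : Set} {P : List V → Set} {d D} → DecidableEquality V
               → (∀ {D D'} → D ⊆ D' → P D → P D') → IsMinSize P d → P D → d ≤ length D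
minSize≤length {D = D} _≟ᵥ_ P-mono (_ , minimal) PD =
  ≤-trans (minimal (deduplicate _≟ᵥ_ D) (deduplicate-! _≟ᵥ_ D) (P-mono (∈-deduplicate⁺ _≟ᵥ_) PD))
          (length-deduplicate _≟ᵥ_ D)

¬closedNeighbour⇒complementAdj : ∀ {k} (F : Graph k) {u v} → ¬ ReflClosure (Adj F) u v
                               → Adj (complement F) u v
¬closedNeighbour⇒complementAdj _ ¬uv = (λ u≡v → ¬uv (fromSum (inj₁ u≡v))) , (λ uv → ¬uv [ uv ])

module _ {m n : ℕ} (G : Graph m) (H : Graph n) where

  closedNeighbour-modular : ∀ {g g' h h'} → ReflClosure (Adj G) g g' → ReflClosure (Adj H) h h'
                          → ReflClosure (ModAdj G H) (g , h) (g' , h')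
  closedNeighbour-modular refl    refl    = refl
  closedNeighbour-modular refl    [ hh' ] = [ inj₁ (refl , hh') ]
  closedNeighbour-modular [ gg' ] refl    = [ inj₂ (inj₁ (gg' , refl)) ]
  closedNeighbour-modular [ gg' ] [ hh' ] = [ inj₂ (inj₂ (inj₁ (gg' , hh'))) ]

  complementAdj-modular : ∀ {g g' h h'} → Adj (complement G) g g' → Adj (complement H) h h'
                        → ModAdj G H (g , h) (g' , h')
  complementAdj-modular (g≢g' , ¬gg') (h≢h' , ¬hh') = inj₂ (inj₂ (inj₂ (g≢g' , h≢h' , ¬gg' , ¬hh')))

  cross : Fin m → List (Fin m) → Fin n → List (Fin n) → List (Fin m × Fin n)
  cross g₀ A h₀ B = map (g₀ ,_) (h₀ ∷ B) ++ map (_, h₀) A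

  module _ {g₀ : Fin m} {A : List (Fin m)} {h₀ : Fin n} {B : List (Fin n)} where

    ∈-cross-column : ∀ {h} → h ∈ h₀ ∷ B → (g₀ , h) ∈ cross g₀ A h₀ B
    ∈-cross-column h∈ = ∈-++⁺ˡ (∈-map⁺ (g₀ ,_) h∈)

    ∈-cross-row : ∀ {g} → g ∈ g₀ ∷ A → (g , h₀) ∈ cross g₀ A h₀ B
    ∈-cross-row (here refl) = ∈-cross-column (here refl)
    ∈-cross-row (there g∈)  = ∈-++⁺ʳ (map (g₀ ,_) (h₀ ∷ B)) (∈-map⁺ (_, h₀) g∈)

    length-cross : length (cross g₀ A h₀ B) ≡ length (g₀ ∷ A) + length (h₀ ∷ B) ∸ 1
    length-cross = begin
      length (map (g₀ ,_) (h₀ ∷ B) ++ map (_, h₀) A)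
        ≡⟨ length-++ (map (g₀ ,_) (h₀ ∷ B)) ⟩
      length (map (g₀ ,_) (h₀ ∷ B)) + length (map (_, h₀) A)
        ≡⟨ cong₂ _+_ (length-map (g₀ ,_) (h₀ ∷ B)) (length-map (_, h₀) A) ⟩
      length (h₀ ∷ B) + length A
        ≡⟨ +-comm (length (h₀ ∷ B)) (length A) ⟩
      length A + length (h₀ ∷ B)
        ∎

    cross-dominating : Dominating (Adj G) (g₀ ∷ A) → Dominating (Adj H) (h₀ ∷ B)
                     → Dominating (ModAdj G H) (cross g₀ A h₀ B)
    cross-dominating domA domB (g , h)
      with ReflClosure.dec _≟_ (adj? G) g₀ g | ReflClosure.dec _≟_ (adj? H) h₀ h
    ... | yes g₀g | _ with dominatedBy⇒closedNeighbour (domB h)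
    ...   | h' , h'∈ , h'h =
            closedNeighbour⇒dominatedBy (∈-cross-column h'∈) (closedNeighbour-modular g₀g h'h)
    cross-dominating domA domB (g , h) | no _ | yes h₀h with dominatedBy⇒closedNeighbour (domA g)
    ...   | g' , g'∈ , g'g =
            closedNeighbour⇒dominatedBy (∈-cross-row g'∈) (closedNeighbour-modular g'g h₀h)
    cross-dominating domA domB (g , h) | no ¬g₀g | no ¬h₀h =
      inj₂ (_ , ∈-cross-column (here refl)
              , complementAdj-modular (¬closedNeighbour⇒complementAdj G ¬g₀g)
                                      (¬closedNeighbour⇒complementAdj H ¬h₀h))

    cross-dominating-complements : TotalDominating (Adj (complement G)) (g₀ ∷ A)
                                 → TotalDominating (Adj (complement H)) (h₀ ∷ B)
                                 → Dominating (ModAdj G H) (cross g₀ A h₀ B)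
    cross-dominating-complements totA totB (g , h)
      with ReflClosure.dec _≟_ (adj? G) g₀ g | ReflClosure.dec _≟_ (adj? H) h₀ h
    ... | yes g₀g | yes h₀h =
          closedNeighbour⇒dominatedBy (∈-cross-column (here refl)) (closedNeighbour-modular g₀g h₀h)
    ... | yes _ | no ¬h₀h with totA g
    ...   | g' , g'∈ , g'g =
            inj₂ (_ , ∈-cross-row g'∈
                    , complementAdj-modular g'g (¬closedNeighbour⇒complementAdj H ¬h₀h))
    cross-dominating-complements totA totB (g , h) | no ¬g₀g | _ with totB h
    ...   | h' , h'∈ , h'h =
            inj₂ (_ , ∈-cross-column h'∈
                    , complementAdj-modular (¬closedNeighbour⇒complementAdj G ¬g₀g) h'h)

  cross-bound : ∀ {P : List (Fin m) → Set} {Q : List (Fin n) → Set} {d a b}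
              → IsDomNumModProd G H d → ¬ P [] → ¬ Q []
              → (∀ {g₀ A h₀ B} → P (g₀ ∷ A) → Q (h₀ ∷ B) → Dominating (ModAdj G H) (cross g₀ A h₀ B))
              → IsMinSize P a → IsMinSize Q b → d ≤ a + b ∸ 1
  cross-bound _ ¬P[] _ _ (([] , _ , P[] , _) , _) _ = ⊥-elim (¬P[] P[])
  cross-bound _ _ ¬Q[] _ _ (([] , _ , Q[] , _) , _) = ⊥-elim (¬Q[] Q[])
  cross-bound γ _ _ cross-dom ((g₀ ∷ A , _ , PA , refl) , _) ((h₀ ∷ B , _ , QB , refl) , _) =
    ≤-trans (minSize≤length (≡-dec _≟_ _≟_) Dominating-mono γ (cross-dom PA QB))
            (≤-reflexive (length-cross {g₀} {A} {h₀} {B}))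

theorem8 : ∀ {m n} (G : Graph (suc m)) (H : Graph (suc n)) (d dG dH : ℕ)
           → IsDomNumModProd G H d → IsDomNum G dG → IsDomNum H dH
           → (d ≤ dG + dH ∸ 1)
             × (∀ tG tH → IsTotDomNum (complement G) tG → IsTotDomNum (complement H) tH
                → d ≤ tG + tH ∸ 1)
theorem8 G H d dG dH γ γG γH =
    cross-bound G H γ (¬Dominating-[] Fin.zero) (¬Dominating-[] Fin.zero) (cross-dominating G H) γG γH
  , λ tG tH γtG γtH →
      cross-bound G H γ (¬TotalDominating-[] Fin.zero) (¬TotalDominating-[] Fin.zero)
                  (cross-dominating-complements G H) γtG γtH
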